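{- There exists a temporal clique $G$ on $n$ vertices such that every temporal $2$-spanner of $G$ has size $\Omega(n^2)$.
   Context: A temporal graph is an undirected graph $G=(V,E)$ with $n=|V|$ vertices together with a labeling $\lambda: E \to \mathbb{N}^+$. A temporal clique is a temporal graph whose underlying graph is complete. A temporal path from $u$ to $v$ is a path from $u$ to $v$ whose traversed edges $e_1,\dots,e_m$ satisfy $\lambda(e_i)\le\lambda(e_{i+1})$ for all $i$; its length is $m$. $d_G(u,v)$ is the minimum length of a temporal path from $u$ to $v$ in $G$ ($+\infty$ if none). A temporal subgraph $H$ of $G$ has $V(H)=V$, $E(H)\subseteq E$ with the same labels. A temporal $\alpha$-spanner of $G$ is a temporal subgraph $H$ with $d_H(u,v)\le\alpha\, d_G(u,v)$ for all $u,v$. The size of $H$ is $|E(H)|$. -}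

module Defs where

open import Data.Nat using (ℕ; zero; suc; _+_; _*_; _≤_)
open import Data.Fin using (Fin; _<?_)
open import Data.Bool using (Bool; true; false; if_then_else_; _∧_)
open import Data.List using (List; map; allFin)
open import Data.Nat.ListAction using (sum)
open import Data.Product using (_×_; ∃-syntax)
open import Relation.Nullary using (¬_; does)
open import Relation.Binary.PropositionalEquality using (_≡_)

-- A labeling of the complete graph on vertex set Fin n:
-- lab u v is the label of edge {u,v} (only meaningful for u ≢ v).
Labeling : ℕ → Set
Labeling n = Fin n → Fin n → ℕ

IsTemporalClique : {n : ℕ} → Labeling n → Set
IsTemporalClique {n} lab =
  ((u v : Fin n) → lab u v ≡ lab v u) ×
  ((u v : Fin n) → ¬ (u ≡ v) → 1 ≤ lab u v)

-- TWalk Adj lab u v m t : a temporal walk from u to v of length m in the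
-- graph with adjacency Adj and labels lab, all of whose labels are ≥ t and
-- non-decreasing along the walk.
data TWalk {n : ℕ} (Adj : Fin n → Fin n → Set) (lab : Labeling n)
     : Fin n → Fin n → ℕ → ℕ → Set where
  nil  : ∀ {u t} → TWalk Adj lab u u zero t
  cons : ∀ {u w v m t} → Adj u w → t ≤ lab u w →
         TWalk Adj lab w v m (lab u w) → TWalk Adj lab u v (suc m) t

-- A temporal path from u to v of length m (labels are ≥ 1 ≥ 0).
TPath : {n : ℕ} → (Fin n → Fin n → Set) → Labeling n → Fin n → Fin n → ℕ → Set
TPath Adj lab u v m = TWalk Adj lab u v m 0

CliqueAdj : {n : ℕ} → Fin n → Fin n → Set
CliqueAdj u v = ¬ (u ≡ v)

SubAdj : {n : ℕ} → (Fin n → Fin n → Bool) → Fin n → Fin n → Set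
SubAdj S u v = ¬ (u ≡ v) × (S u v ≡ true)

SymmetricSel : {n : ℕ} → (Fin n → Fin n → Bool) → Set
SymmetricSel {n} S = (u v : Fin n) → S u v ≡ S v u

-- Size of H = number of unordered pairs {i,j} (counted as i < j) that are edges.
size : {n : ℕ} → (Fin n → Fin n → Bool) → ℕ
size {n} S =
  sum (map (λ i → sum (map (λ j → if does (i <? j) ∧ S i j then 1 else 0)
                           (allFin n)))
           (allFin n))

-- H (given by S) is a temporal α-spanner of the temporal clique lab:
-- d_H(u,v) ≤ α · d_G(u,v) for all u, v. Unfolded: for every temporal path
-- in G from u to v of length m there is one in H of length ≤ α * m
-- (this covers d_G = ∞ vacuously).
IsSpanner : {n : ℕ} → ℕ → Labeling n → (Fin n → Fin n → Bool) → Set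
IsSpanner {n} α lab S =
  (u v : Fin n) (m : ℕ) → TPath CliqueAdj lab u v m →
  ∃[ m' ] (m' ≤ α * m × TPath (SubAdj S) lab u v m')

{-# OPTIONS --safe #-}
module Submission where

open import Defs
open import Data.Nat using (ℕ; zero; suc; _+_; _*_; _<_; _≤_; z≤n; s≤s)
open import Data.Nat.Properties
  using ( +-assoc; +-comm; +-identityʳ; +-suc; *-suc; *-identityʳ; ≤-refl; ≤-reflexive; ≤-trans
        ; <-irrefl; <⇒≱; m≤m+n; m≤n+m; m≤n⇒m≤1+n; +-mono-≤; *-mono-≤; *-monoʳ-≤; module ≤-Reasoning)
open import Data.Nat.ListAction using (sum)
open import Data.Nat.Tactic.RingSolver using (solve)
import Data.Fin as Fin
open import Data.Fin using (Fin; toℕ; splitAt; _↑ˡ_; _↑ʳ_; _<?_)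
open import Data.Fin.Properties using (toℕ<n; toℕ-↑ˡ; toℕ-↑ʳ; splitAt-↑ˡ; splitAt-↑ʳ)
open import Data.Bool using (Bool; true; if_then_else_; _∧_)
open import Data.List using (map; allFin; tabulate; []; _∷_)
open import Data.List.Properties using (map-tabulate; tabulate-cong)
open import Data.Product using (_×_; _,_; ∃-syntax)
open import Data.Sum using ([_,_]′)
open import Function using (id; _∘_; const; case_of_)
open import Relation.Nullary using (¬_; does; contradiction)
open import Relation.Nullary.Decidable using (dec-true)
open import Relation.Binary.PropositionalEquality
  using (_≡_; refl; sym; trans; cong)

-- Split the vertices into a left part A of size h and a right part B of
-- size r, and label an edge by 1 + (number of its endpoints in A).  For
-- a ∈ A and b ∈ B a two-edge temporal path a → w → b would need
-- λ(aw) ≤ λ(wb), but λ(aw) = λ(wb) + 1 whatever side w lies on.  So every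
-- temporal 2-spanner must keep all h·r edges between A and B, and for
-- h ≈ r ≈ n/2 these are Ω(n²) edges.

sum-tabulate-↑ : ∀ m {n} (f : Fin (m + n) → ℕ) →
  sum (tabulate f) ≡ sum (tabulate (f ∘ (_↑ˡ n))) + sum (tabulate (f ∘ (m ↑ʳ_)))
sum-tabulate-↑ zero    f = refl
sum-tabulate-↑ (suc m) f =
  trans (cong (f Fin.zero +_) (sum-tabulate-↑ m (f ∘ Fin.suc))) (sym (+-assoc (f Fin.zero) _ _))

sum-tabulate-≥ : ∀ {n} c (f : Fin n → ℕ) → (∀ i → c ≤ f i) → n * c ≤ sum (tabulate f)
sum-tabulate-≥ {zero}  c f c≤f = z≤n
sum-tabulate-≥ {suc n} c f c≤f =
  +-mono-≤ (c≤f Fin.zero) (sum-tabulate-≥ c (f ∘ Fin.suc) (c≤f ∘ Fin.suc))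

sum²-tabulate-≥-block : ∀ h r (f : Fin (h + r) → Fin (h + r) → ℕ) →
  (∀ a b → 1 ≤ f (a ↑ˡ r) (h ↑ʳ b)) → h * r ≤ sum (tabulate λ i → sum (tabulate (f i)))
sum²-tabulate-≥-block h r f 1≤f = begin
  h * r
    ≤⟨ sum-tabulate-≥ r (row ∘ (_↑ˡ r)) block-row ⟩
  sum (tabulate (row ∘ (_↑ˡ r)))
    ≤⟨ m≤m+n _ _ ⟩
  sum (tabulate (row ∘ (_↑ˡ r))) + sum (tabulate (row ∘ (h ↑ʳ_)))
    ≡⟨ sym (sum-tabulate-↑ h row) ⟩
  sum (tabulate row) ∎
  where
  open ≤-Reasoning
  row : Fin (h + r) → ℕ
  row i = sum (tabulate (f i))
  block-row : ∀ a → r ≤ row (a ↑ˡ r)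
  block-row a = begin
    r
      ≡⟨ sym (*-identityʳ r) ⟩
    r * 1
      ≤⟨ sum-tabulate-≥ 1 (f (a ↑ˡ r) ∘ (h ↑ʳ_)) (1≤f a) ⟩
    sum (tabulate (f (a ↑ˡ r) ∘ (h ↑ʳ_)))
      ≤⟨ m≤n+m _ _ ⟩
    sum (tabulate (f (a ↑ˡ r) ∘ (_↑ˡ r))) + sum (tabulate (f (a ↑ˡ r) ∘ (h ↑ʳ_)))
      ≡⟨ sym (sum-tabulate-↑ h (f (a ↑ˡ r))) ⟩
    row (a ↑ˡ r) ∎

isEdge : ∀ {n} → (Fin n → Fin n → Bool) → Fin n → Fin n → ℕ
isEdge S i j = if does (i <? j) ∧ S i j then 1 else 0

size-tabulate : ∀ {n} (S : Fin n → Fin n → Bool) →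
  size S ≡ sum (tabulate λ i → sum (tabulate (isEdge S i)))
size-tabulate {n} S = cong sum (trans (map-tabulate id row)
  (tabulate-cong λ i → cong sum (map-tabulate id (isEdge S i))))
  where
  row : Fin n → ℕ
  row i = sum (map (isEdge S i) (allFin n))

↑ˡ<↑ʳ : ∀ {h r} (a : Fin h) (b : Fin r) → toℕ (a ↑ˡ r) < toℕ (h ↑ʳ b)
↑ˡ<↑ʳ {h} {r} a b rewrite toℕ-↑ˡ a r | toℕ-↑ʳ h b = ≤-trans (toℕ<n a) (m≤m+n h (toℕ b))

size-≥-crossing : ∀ h r (S : Fin (h + r) → Fin (h + r) → Bool) →
  (∀ a b → S (a ↑ˡ r) (h ↑ʳ b) ≡ true) → h * r ≤ size S
size-≥-crossing h r S crossing rewrite size-tabulate S =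
  sum²-tabulate-≥-block h r (isEdge S) crossing-isEdge
  where
  crossing-isEdge : ∀ a b → 1 ≤ isEdge S (a ↑ˡ r) (h ↑ʳ b)
  crossing-isEdge a b rewrite dec-true (a ↑ˡ r <? h ↑ʳ b) (↑ˡ<↑ʳ a b) | crossing a b = ≤-refl

NoRelay : ∀ {n} → Labeling n → Fin n → Fin n → Set
NoRelay lab a b = ∀ w → lab w b < lab a w

NoRelay⇒≢ : ∀ {n} {lab : Labeling n} {a b} → NoRelay lab a b → ¬ a ≡ b
NoRelay⇒≢ {a = a} noRelay refl = <-irrefl refl (noRelay a)

spanner-keeps-edge : ∀ {n} {lab : Labeling n} {S} {a b : Fin n} →
  IsSpanner 2 lab S → NoRelay lab a b → S a b ≡ true
spanner-keeps-edge {lab = lab} {a = a} {b} spanner noRelay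
  with spanner a b 1 (cons (NoRelay⇒≢ {lab = lab} noRelay) z≤n nil)
... | _ , _ , nil = contradiction refl (NoRelay⇒≢ {lab = lab} noRelay)
... | _ , _ , cons (_ , Sab) _ nil = Sab
... | _ , _ , cons {w = w} _ _ (cons _ aw≤wb nil) = contradiction aw≤wb (<⇒≱ (noRelay w))
... | _ , s≤s (s≤s ()) , cons _ _ (cons _ _ (cons _ _ _))

leftIndicator : ∀ h {r} → Fin (h + r) → ℕ
leftIndicator h = [ const 1 , const 0 ]′ ∘ splitAt h

leftIndicator-↑ˡ : ∀ {h} r (a : Fin h) → leftIndicator h (a ↑ˡ r) ≡ 1
leftIndicator-↑ˡ {h} r a = cong [ const 1 , const 0 ]′ (splitAt-↑ˡ h a r)

leftIndicator-↑ʳ : ∀ h {r} (b : Fin r) → leftIndicator h (h ↑ʳ b) ≡ 0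
leftIndicator-↑ʳ h {r} b = cong [ const 1 , const 0 ]′ (splitAt-↑ʳ h r b)

bipartiteLabeling : ∀ h r → Labeling (h + r)
bipartiteLabeling h r u v = suc (leftIndicator h u + leftIndicator h v)

bipartiteLabeling-isTemporalClique : ∀ h r → IsTemporalClique (bipartiteLabeling h r)
bipartiteLabeling-isTemporalClique h r =
  (λ u v → cong suc (+-comm (leftIndicator h u) (leftIndicator h v))) , (λ _ _ _ → s≤s z≤n)

bipartiteLabeling-noRelay : ∀ h r (a : Fin h) (b : Fin r) →
  NoRelay (bipartiteLabeling h r) (a ↑ˡ r) (h ↑ʳ b)
bipartiteLabeling-noRelay h r a b w rewrite leftIndicator-↑ˡ r a | leftIndicator-↑ʳ h b =
  s≤s (s≤s (≤-reflexive (+-identityʳ (leftIndicator h w))))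

bipartite-spanner-size : ∀ h r (S : Fin (h + r) → Fin (h + r) → Bool) →
  IsSpanner 2 (bipartiteLabeling h r) S → h * r ≤ size S
bipartite-spanner-size h r S spanner = size-≥-crossing h r S λ a b →
  spanner-keeps-edge spanner (bipartiteLabeling-noRelay h r a b)

halve : ∀ n → 2 ≤ n → ∃[ h ] ∃[ r ] (n ≡ h + r × n ≤ 3 * h × n ≤ 2 * r)
halve 1 (s≤s ())
halve 2 _ = 1 , 1 , refl , s≤s (s≤s z≤n) , ≤-refl
halve 3 _ = 1 , 2 , refl , ≤-refl , s≤s (s≤s (s≤s z≤n))
halve (suc (suc n@(suc (suc _)))) _ with halve n (s≤s (s≤s z≤n))
... | h , r , n≡h+r , n≤3h , n≤2r =
  suc h , suc r , cong suc (trans (cong suc n≡h+r) (sym (+-suc h r))) ,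
  ≤-trans (s≤s (s≤s (m≤n⇒m≤1+n n≤3h))) (≤-reflexive (sym (*-suc 3 h))) ,
  ≤-trans (s≤s (s≤s n≤2r)) (≤-reflexive (sym (*-suc 2 r)))

square-≤ : ∀ {n} h r → n ≤ 3 * h → n ≤ 2 * r → n * n ≤ 6 * (h * r)
square-≤ {n} h r n≤3h n≤2r = begin
  n * n            ≤⟨ *-mono-≤ n≤3h n≤2r ⟩
  3 * h * (2 * r)  ≡⟨ solve (h ∷ r ∷ []) ⟩
  6 * (h * r)      ∎
  where open ≤-Reasoning

mainTheorem2 : ∃[ k ] ∃[ N ] ((n : ℕ) → N ≤ n →
                   ∃[ lab ] (IsTemporalClique {n} lab ×
                     ((S : Fin n → Fin n → Bool) → SymmetricSel S →
                       IsSpanner 2 lab S → n * n ≤ k * size S)))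
mainTheorem2 = 6 , 2 , λ n 2≤n → case halve n 2≤n of λ where
  (h , r , refl , n≤3h , n≤2r) →
    bipartiteLabeling h r , bipartiteLabeling-isTemporalClique h r , λ S _ spanner →
      ≤-trans (square-≤ h r n≤3h n≤2r) (*-monoʳ-≤ 6 (bipartite-spanner-size h r S spanner))
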